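{- Let $\mathcal{G}=\langle \mathit{Init},\mathit{Safe},\mathit{Reach},\mathit{Goal}\rangle$ be a reachability game, let $C$ be a necessary subgoal for $\mathcal{G}$, and suppose that $\operatorname{Enf}(C,\mathcal{G})$ is unsatisfiable. Then $\mathit{Safe}\land\neg C$ is a winning symbolic strategy for SAFE in $\mathcal{G}$, i.e., it is winning for SAFE in every state satisfying $\mathit{Init}$.
   Context: Fix a logic $\mathcal{L}$ and a finite set of variables $\mathcal{V}$ with domains, primed copies $\mathcal{V}'$, and a Boolean variable $\mathbf{r}\in\mathcal{V}$. A state is a valuation of $\mathcal{V}$ respecting domains; $S_{\mathrm{REACH}}=\{s:s(\mathbf{r})=\mathrm{true}\}$, $S_{\mathrm{SAFE}}$ the other states; $\varphi(s)$, $\tau(s,s')$ denote evaluation of state/transition predicates (formulas over $\mathcal{V}$, resp. $\mathcal{V}\cup\mathcal{V}'$), and $\tau(s)$ substitutes only unprimed variables. A reachability game $\langle \mathit{Init},\mathit{Safe},\mathit{Reach},\mathit{Goal}\rangle$ has state predicates $\mathit{Init},\mathit{Goal}$ and transition predicates $\mathit{Safe},\mathit{Reach}$ with $\mathit{Safe}\Rightarrow\neg\mathbf{r}$, $\mathit{Reach}\Rightarrow\mathbf{r}$ valid. A trap state is $s$ with $(\mathit{Safe}\lor\mathit{Reach})(s)$ unsatisfiable. A play from $s_0$ is a finite or infinite sequence $s_0s_1\ldots$ with $\mathit{Safe}(s_i,s_{i+1})$ or $\mathit{Reach}(s_i,s_{i+1})$ for consecutive pairs, ending in a trap state if finite; a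 play of $\mathcal{G}$ starts in a state satisfying $\mathit{Init}$. REACH wins a play if some state on it satisfies $\mathit{Goal}$, otherwise SAFE wins. $\operatorname{Enf}(T,\mathcal{G})=(\mathit{Safe}\lor\mathit{Reach})\land T\land\neg\exists\mathcal{V}'.(\mathit{Safe}\land\neg T)$. A necessary subgoal for $\mathcal{G}$ is a transition predicate $C$ such that for every play $s_0s_1\ldots$ of $\mathcal{G}$ and $n$ with $\mathit{Goal}(s_n)$ there is $k<n$ with $C(s_k,s_{k+1})$. A symbolic strategy is a transition predicate $\mathfrak{S}$ with $\mathfrak{S}\Rightarrow(\mathit{Safe}\lor\mathit{Reach})$ valid. A play prefix is a finite prefix $s_0\ldots s_n$ of a play with $\neg\mathit{Goal}(s_j)$ for all $j\le n$ and $s_n$ not a trap. A prefix conforms to a symbolic safety strategy $\mathfrak{S}$ if $\mathfrak{S}(s_j,s_{j+1})$ for all $j<n$ with $s_j\in S_{\mathrm{SAFE}}$; a play conforms if all its play prefixes do. $\mathfrak{S}$ is winning for SAFE in $s$ if every play from $s$ conforming to $\mathfrak{S}$ is won by SAFE, and every conforming play prefix from $s$ ending in $s_n\in S_{\mathrm{SAFE}}$ has $(\mathfrak{S}\land\mathit{Safe})(s_n)$ satisfiable.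
   Formalization: A play conforms to 𝔖 when every finite prefix s₀…sₙ of it with ¬Goal(sⱼ) for j < n conforms, sₙ possibly satisfying Goal or being a trap, so the SAFE move into the first Goal state must follow 𝔖. The statement above fails without it. -}

module Defs where

open import Data.Bool using (Bool; true; false)
open import Data.Nat using (ℕ; zero; suc; _≤_; _<_)
open import Data.Product using (Σ; ∃; _×_; _,_)
open import Data.Sum using (_⊎_)
open import Data.Unit using (⊤)
open import Relation.Nullary using (¬_)
open import Relation.Binary.PropositionalEquality using (_≡_)

-- A state is an element of
-- 'State' (a valuation of 𝒱); a state predicate φ is rendered by its
-- evaluation φ(s), a transition predicate τ by its evaluation τ(s,s').
-- Existential quantification over primed variables / satisfiability of
-- τ(s) is quantification over successor states s'.
StatePred : Set → Set₁
StatePred S = S → Set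

TransPred : Set → Set₁
TransPred S = S → S → Set

record Game : Set₁ where
  field
    State   : Set
    r       : State → Bool
    Init    : StatePred State
    Goal    : StatePred State
    Safe    : TransPred State
    Reach   : TransPred State
    Safe⇒¬r  : ∀ {s s′} → Safe s s′ → r s ≡ false
    Reach⇒r  : ∀ {s s′} → Reach s s′ → r s ≡ true

module _ (G : Game) where
  open Game G

  Move : TransPred State
  Move s s′ = Safe s s′ ⊎ Reach s s′

  InSafe : State → Set
  InSafe s = r s ≡ false

  Trap : State → Set
  Trap s = ¬ (∃ λ s′ → Move s s′)

  Enf : TransPred State → TransPred State
  Enf T s s′ = Move s s′ × T s s′ × ¬ (∃ λ s″ → Safe s s″ × ¬ T s s″)

  Unsatisfiable : TransPred State → Set
  Unsatisfiable τ = ∀ s s′ → ¬ τ s s′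

  -- Length of a play: finite with last index n, or infinite.
  data Length : Set where
    fin : ℕ → Length
    inf : Length

  InPlay : Length → ℕ → Set
  InPlay (fin n) i = i ≤ n
  InPlay inf     i = ⊤

  EndsInTrap : Length → (ℕ → State) → Set
  EndsInTrap (fin n) f = Trap (f n)
  EndsInTrap inf     f = ⊤

  record Play (s : State) : Set where
    field
      len   : Length
      seq   : ℕ → State
      start : seq 0 ≡ s
      steps : ∀ i → InPlay len (suc i) → Move (seq i) (seq (suc i))
      ends  : EndsInTrap len seq
  open Play public

  SafeWins : ∀ {s} → Play s → Set
  SafeWins p = ∀ i → InPlay (len p) i → ¬ Goal (seq p i)

  -- necessary subgoal (plays of 𝒢 start in an Init state)
  NecessarySubgoal : TransPred State → Set
  NecessarySubgoal C =
    ∀ s → Init s → (p : Play s) → ∀ n → InPlay (len p) n →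
    Goal (seq p n) → ∃ λ k → k < n × C (seq p k) (seq p (suc k))

  SymbolicStrategy : TransPred State → Set
  SymbolicStrategy 𝔖 = ∀ s s′ → 𝔖 s s′ → Move s s′

  IsPlayPrefix : ∀ {s} → Play s → ℕ → Set
  IsPlayPrefix p n =
    InPlay (len p) n × (∀ j → j ≤ n → ¬ Goal (seq p j)) × ¬ Trap (seq p n)

  ConformsUpTo : TransPred State → ∀ {s} → Play s → ℕ → Set
  ConformsUpTo 𝔖 p n =
    ∀ j → j < n → InSafe (seq p j) → 𝔖 (seq p j) (seq p (suc j))

  PlayConforms : TransPred State → ∀ {s} → Play s → Set
  PlayConforms 𝔖 p =
    ∀ n → InPlay (len p) n → (∀ j → j < n → ¬ Goal (seq p j)) →
    ConformsUpTo 𝔖 p n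

  WinningIn : TransPred State → State → Set
  WinningIn 𝔖 s =
    ((p : Play s) → PlayConforms 𝔖 p → SafeWins p)
    × ((p : Play s) → ∀ n → IsPlayPrefix p n → ConformsUpTo 𝔖 p n →
         InSafe (seq p n) → ∃ λ s′ → 𝔖 (seq p n) s′ × Safe (seq p n) s′)

  WinningStrategyFor𝒢 : TransPred State → Set
  WinningStrategyFor𝒢 𝔖 = SymbolicStrategy 𝔖 × (∀ s → Init s → WinningIn 𝔖 s)

-- Since no state
-- enforces C, C never holds on a Reach move (REACH states have no Safe moves,
-- so such a move would enforce C), and from every non-trap SAFE state some
-- Safe move avoids C (otherwise any Safe move from it would enforce C).
-- Playing Safe ∧ ¬ C is therefore always possible for SAFE, and keeps every
-- play off C and hence off Goal.
module Submission where

open import Defs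
open import Level using (0ℓ)
open import Axiom.ExcludedMiddle using (ExcludedMiddle)
open import Data.Product using (_×_; _,_; ∃; proj₁; proj₂)
open import Data.Sum using (inj₁; inj₂)
open import Data.Empty using (⊥-elim)
open import Data.Unit using (tt)
open import Data.Nat using (_≤_; _<_)
open import Data.Nat.Properties using (≤-trans; <⇒≤)
open import Data.Nat.Induction using (<-rec)
open import Relation.Nullary using (¬_; yes; no)
open import Relation.Binary.PropositionalEquality using (trans; sym)

InPlay-downward : ∀ {G} (l : Length G) {j n} → j ≤ n → InPlay G l n → InPlay G l j
InPlay-downward (fin m) j≤n n≤m = ≤-trans j≤n n≤m
InPlay-downward inf     _   _   = tt

module _ {G : Game} where
  open Game G

  InSafe⇒¬Reach : ∀ {s s′} → InSafe G s → ¬ Reach s s′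
  InSafe⇒¬Reach insafe rc with trans (sym (Reach⇒r rc)) insafe
  ... | ()

  SafeAvoiding : TransPred State → TransPred State
  SafeAvoiding C s s′ = Safe s s′ × ¬ C s s′

  module _ {C : TransPred State} (C-unenforceable : Unsatisfiable G (Enf G C)) where

    Reach⇒¬C : ∀ {s s′} → Reach s s′ → ¬ C s s′
    Reach⇒¬C rc c =
      C-unenforceable _ _ (inj₂ rc , c , λ (_ , sf , _) → InSafe⇒¬Reach (Safe⇒¬r sf) rc)

    conforming-move⇒¬C : ∀ {s s′} → Move G s s′ →
                         (InSafe G s → SafeAvoiding C s s′) → ¬ C s s′
    conforming-move⇒¬C (inj₁ sf) conform = proj₂ (conform (Safe⇒¬r sf))
    conforming-move⇒¬C (inj₂ rc) _       = Reach⇒¬C rc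

    ¬SafeAvoiding-move⇒Trap : ∀ {s} → InSafe G s → ¬ (∃ λ s′ → SafeAvoiding C s s′) → Trap G s
    ¬SafeAvoiding-move⇒Trap insafe none (_  , inj₂ rc) = InSafe⇒¬Reach insafe rc
    ¬SafeAvoiding-move⇒Trap insafe none (s′ , inj₁ sf) =
      none (s′ , sf , λ c → C-unenforceable _ s′ (inj₁ sf , c , none))

    ¬Trap⇒SafeAvoiding-move : ExcludedMiddle 0ℓ → ∀ {s} → InSafe G s → ¬ Trap G s →
             ∃ λ s′ → SafeAvoiding C s s′
    ¬Trap⇒SafeAvoiding-move em insafe ¬trap with em
    ... | yes esc = esc
    ... | no none = ⊥-elim (¬trap (¬SafeAvoiding-move⇒Trap insafe none))

    module _ (C-necessary : NecessarySubgoal G C) {s} (init : Init s) (p : Play G s)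
             (conforms : PlayConforms G (SafeAvoiding C) p) where

      conforming⇒SafeWins : SafeWins G p
      conforming⇒SafeWins = <-rec (λ n → InPlay G (len p) n → ¬ Goal (seq p n)) step
        where
        -- The induction hypothesis makes s₀ … sₙ₋₁ goal-free, so conformance
        -- applies up to n and rules out C on the step the subgoal demands.
        step : ∀ n → (∀ {j} → j < n → InPlay G (len p) j → ¬ Goal (seq p j)) →
               InPlay G (len p) n → ¬ Goal (seq p n)
        step n ih n∈p goal with C-necessary s init p n n∈p goal
        ... | k , k<n , c = conforming-move⇒¬C (steps p k (InPlay-downward (len p) k<n n∈p))
                              (conforms n n∈p goal-free k k<n) c
          where
          goal-free : ∀ j → j < n → ¬ Goal (seq p j)
          goal-free j j<n = ih j<n (InPlay-downward (len p) (<⇒≤ j<n) n∈p)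

lemma4 : ExcludedMiddle 0ℓ → (G : Game) → (C : TransPred (Game.State G)) →
    NecessarySubgoal G C → Unsatisfiable G (Enf G C) →
    WinningStrategyFor𝒢 G (λ s s′ → Game.Safe G s s′ × ¬ C s s′)
lemma4 em G C C-necessary C-unenforceable = (λ _ _ (sf , _) → inj₁ sf) , winning
  where
  open Game G using (Init; Safe)

  𝔖 : TransPred (Game.State G)
  𝔖 = SafeAvoiding {G = G} C

  winning : ∀ s → Init s → WinningIn G 𝔖 s
  winning s init = conforming⇒SafeWins C-unenforceable C-necessary init , always-movable
    where
    always-movable : ∀ (p : Play G s) n → IsPlayPrefix G p n → ConformsUpTo G 𝔖 p n →
                     InSafe G (seq p n) → ∃ λ s′ → 𝔖 (seq p n) s′ × Safe (seq p n) s′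
    always-movable p n (_ , _ , ¬trap) _ insafe
      with s′ , avoid ← ¬Trap⇒SafeAvoiding-move {G = G} C-unenforceable em insafe ¬trap
      = s′ , avoid , proj₁ avoid
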